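{- Let $m = p^\mu$ with $p$ prime, and let $A=(a_{ij})$ be a random $n\times n$ symmetric matrix over $\mathbf{Z}_m$ (entries chosen independently and uniformly from $\{1,\dots,m\}$ subject to $a_{ij}=a_{ji}$). Suppose that $n>2$, $a_{11} \equiv 0 \pmod p$, and $a_{12} \not\equiv 0 \pmod p$. Then there is a matrix $V$ such that $$V A V^T \equiv \begin{pmatrix} a_{11} & a_{12} & 0 \\ a_{21} & a_{22} & 0 \\ 0 & 0 & A'' \end{pmatrix} \pmod{p^\mu},$$ where $A''$ is a random $(n-2)\times(n-2)$ symmetric matrix over $\mathbf{Z}_m$.
   Context: Setting: $m=p^\mu$ is a prime power; a random symmetric matrix over $\mathbf{Z}_m=\{1,2,\ldots,m\}$ has entries chosen independently and uniformly subject to symmetry. The zero blocks in the displayed matrix are the off-diagonal blocks of sizes $2\times(n-2)$ and $(n-2)\times 2$. -}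

module Defs where

open import Data.Nat using (ℕ; zero; suc; _+_; _*_; _%_)
open import Data.Nat.Properties using (_≟_)
open import Data.Fin using (Fin; zero; suc; toℕ)
open import Data.Fin.Properties using (all?)
open import Data.List using (List; []; _∷_; map; concatMap; filter; length; allFin)
open import Data.Product using (_×_; _,_)
open import Relation.Binary.PropositionalEquality using (_≡_)
open import Relation.Nullary using (Dec; ¬_; yes; no)
open import Relation.Nullary.Decidable using (_×-dec_; ¬?)

Mat : Set → ℕ → Set
Mat X k = Fin k → Fin k → X

-- reduction mod m (with the harmless convention x mod 0 = x)
modN : ℕ → ℕ → ℕ
modN zero    x = x
modN (suc k) x = x % suc k

_≡_[mod_] : ℕ → ℕ → ℕ → Set
x ≡ y [mod m ] = modN m x ≡ modN m y

infix 4 _≡_[mod_]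

≡[mod]-dec : ∀ x y m → Dec (x ≡ y [mod m ])
≡[mod]-dec x y m = modN m x ≟ modN m y

∑ : ∀ {k} → (Fin k → ℕ) → ℕ
∑ {zero}  f = 0
∑ {suc k} f = f zero + ∑ (λ i → f (suc i))

-- matrix product and transpose (integer matrices represented over ℕ;
-- all statements are only up to congruence mod m)
_⊗_ : ∀ {k} → Mat ℕ k → Mat ℕ k → Mat ℕ k
(M ⊗ N) i j = ∑ (λ l → M i l * N l j)

infixl 7 _⊗_

_ᵀ : ∀ {k} → Mat ℕ k → Mat ℕ k
(M ᵀ) i j = M j i

idMat : ∀ {k} → Mat ℕ k
idMat zero    zero    = 1
idMat zero    (suc j) = 0
idMat (suc i) zero    = 0
idMat (suc i) (suc j) = idMat i j

-- an element of Z_m = {0,…,m-1} (≅ {1,…,m}) viewed as a natural number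
entries : ∀ {m k} → Mat (Fin m) k → Mat ℕ k
entries A i j = toℕ (A i j)

Symmetric : ∀ {m k} → Mat (Fin m) k → Set
Symmetric A = ∀ i j → A i j ≡ A j i

InvertibleMod : ∀ {k} → ℕ → Mat ℕ k → Set
InvertibleMod {k} m V =
  Data.Product.Σ (Mat ℕ k) (λ W → ∀ i j → (V ⊗ W) i j ≡ idMat i j [mod m ])

allFuns : ∀ {X : Set} (k : ℕ) → List X → List (Fin k → X)
allFuns zero    xs = (λ ()) ∷ []
allFuns (suc k) xs =
  concatMap (λ x → map (λ f → λ { zero → x ; (suc i) → f i }) (allFuns k xs)) xs

-- the list of all k × k matrices over Z_m (the sample space of entries)
allMats : (m k : ℕ) → List (Mat (Fin m) k)
allMats m k = allFuns k (allFuns k (allFin m))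

countMats : ∀ (m k : ℕ) {P : Mat (Fin m) k → Set} →
            (∀ A → Dec (P A)) → ℕ
countMats m k P? = length (filter P? (allMats m k))

Symmetric? : ∀ {m k} (A : Mat (Fin m) k) → Dec (Symmetric A)
Symmetric? A = all? (λ i → all? (λ j → Data.Fin.Properties._≟_ (A i j) (A j i)))

-- For n = k + 2: the matrix V A Vᵀ (over ℕ), its lower-right (n-2)×(n-2) block
-- reduced mod m is A''.
conj : ∀ {m k} → Mat ℕ k → Mat (Fin m) k → Mat ℕ k
conj V A = V ⊗ entries A ⊗ (V ᵀ)

Event : (p m k : ℕ) → (Mat (Fin m) (suc (suc k)) → Mat ℕ (suc (suc k))) →
        Fin m → Fin m → Fin m → Mat (Fin m) k → Mat (Fin m) (suc (suc k)) → Set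
Event p m k V t₁₁ t₁₂ t₂₂ B A =
  Symmetric A ×
  (toℕ (A zero zero) ≡ 0 [mod p ]) ×
  (¬ (toℕ (A zero (suc zero)) ≡ 0 [mod p ])) ×
  (A zero zero ≡ t₁₁) × (A zero (suc zero) ≡ t₁₂) × (A (suc zero) (suc zero) ≡ t₂₂) ×
  (∀ i j → conj (V A) A (suc (suc i)) (suc (suc j)) ≡ toℕ (B i j) [mod m ])

Event? : ∀ p m k V t₁₁ t₁₂ t₂₂ B A → Dec (Event p m k V t₁₁ t₁₂ t₂₂ B A)
Event? p m k V t₁₁ t₁₂ t₂₂ B A =
  Symmetric? A ×-dec
  ≡[mod]-dec (toℕ (A zero zero)) 0 p ×-dec
  ¬? (≡[mod]-dec (toℕ (A zero (suc zero))) 0 p) ×-dec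
  Data.Fin.Properties._≟_ (A zero zero) t₁₁ ×-dec
  Data.Fin.Properties._≟_ (A zero (suc zero)) t₁₂ ×-dec
  Data.Fin.Properties._≟_ (A (suc zero) (suc zero)) t₂₂ ×-dec
  all? (λ i → all? (λ j →
    ≡[mod]-dec (conj (V A) A (suc (suc i)) (suc (suc j))) (toℕ (B i j)) m))

module Submission where

open import Defs
open import Data.Nat using (ℕ; suc; _^_; _≤_)
open import Data.Nat.Primality using (Prime)
open import Data.Fin using (Fin; zero; suc; toℕ)
open import Data.Product using (Σ; _×_)
open import Relation.Binary.PropositionalEquality using (_≡_)
open import Relation.Nullary using (¬_)

open import Data.Nat using (NonZero)
open import Data.Nat.Properties using (m^n≢0)
open import Data.Nat.Primality using (prime⇒nonZero)
open import Data.Product using (_,_)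

-- Idea.  The top-left determinant d = a₁₁a₂₂ − a₁₂² is ≡ −a₁₂² ≢ 0 (mod p), hence a unit
-- modulo p^μ (Bézout).  With w = d⁻¹ the border row (x , y) = (a_{i+2,1} , a_{i+2,2}) is
-- eliminated by  α = (a₁₂y − a₂₂x)w,  β = (a₁₂x − a₁₁y)w,  and V is the shear ( I₂ 0 ; Γ I_k )
-- whose block Γ has rows (α_i , β_i): it is invertible (its inverse is the shear by −Γ), keeps
-- the top-left block, and clears the off-diagonal blocks.  Moreover the entry (i , j) of A″ is
-- a_{i+2,j+2} plus a term depending only on the first two rows and columns of A, on which V
-- also only depends.  So adding B′ − B to the lower block of A, an entrywise cyclic shift that
-- fixes the border, is a bijection of the sample space carrying {A″ ≡ B} onto {A″ ≡ B′}.

module Shears where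

  open import Data.Nat using (zero; _+_; _*_)
  open import Data.Nat.Properties using (+-identityʳ; *-comm)
  open import Data.Nat.Divisibility using (n∣m⇒m%n≡0; m∣m*n)
  open import Data.Nat.Tactic.RingSolver using (solve-∀)
  open import Relation.Binary.PropositionalEquality using (refl; trans; cong; cong₂)

  ∑-cong : ∀ {k} {f g : Fin k → ℕ} → (∀ i → f i ≡ g i) → ∑ f ≡ ∑ g
  ∑-cong {zero}  f≡g = refl
  ∑-cong {suc k} f≡g = cong₂ _+_ (f≡g zero) (∑-cong (λ i → f≡g (suc i)))

  ∑-zero : ∀ k → ∑ {k} (λ _ → 0) ≡ 0
  ∑-zero zero    = refl
  ∑-zero (suc k) = ∑-zero k

  ∑-idMat : ∀ {k} (i : Fin k) (f : Fin k → ℕ) → ∑ (λ l → idMat i l * f l) ≡ f i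
  ∑-idMat {suc k} zero    f =
    trans (cong₂ _+_ (+-identityʳ (f zero)) (∑-zero k)) (+-identityʳ (f zero))
  ∑-idMat {suc k} (suc i) f = ∑-idMat i (λ l → f (suc l))

  ⊗-cong : ∀ {k} {M M′ N N′ : Mat ℕ k} → (∀ r c → M r c ≡ M′ r c) → (∀ r c → N r c ≡ N′ r c) →
           ∀ r c → (M ⊗ N) r c ≡ (M′ ⊗ N′) r c
  ⊗-cong M≡M′ N≡N′ r c = ∑-cong (λ l → cong₂ _*_ (M≡M′ r l) (N≡N′ l c))

  module _ {k : ℕ} where

    shear : (α β : Fin k → ℕ) → Mat ℕ (suc (suc k))
    shear α β zero          j             = idMat zero j
    shear α β (suc zero)    j             = idMat (suc zero) j
    shear α β (suc (suc i)) zero          = α i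
    shear α β (suc (suc i)) (suc zero)    = β i
    shear α β (suc (suc i)) (suc (suc j)) = idMat i j

    shear-cong : ∀ {α β α′ β′} → (∀ i → α i ≡ α′ i) → (∀ i → β i ≡ β′ i) →
                 ∀ r c → shear α β r c ≡ shear α′ β′ r c
    shear-cong α≡α′ β≡β′ zero          c             = refl
    shear-cong α≡α′ β≡β′ (suc zero)    c             = refl
    shear-cong α≡α′ β≡β′ (suc (suc i)) zero          = α≡α′ i
    shear-cong α≡α′ β≡β′ (suc (suc i)) (suc zero)    = β≡β′ i
    shear-cong α≡α′ β≡β′ (suc (suc i)) (suc (suc j)) = refl

    shearRow : (α β : Fin k → ℕ) → Fin (suc (suc k)) → (Fin (suc (suc k)) → ℕ) → ℕ
    shearRow α β zero          f = f zero
    shearRow α β (suc zero)    f = f (suc zero)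
    shearRow α β (suc (suc i)) f = α i * f zero + (β i * f (suc zero) + f (suc (suc i)))

    shearRow-cong : ∀ {α β} r {f g} → (∀ l → f l ≡ g l) → shearRow α β r f ≡ shearRow α β r g
    shearRow-cong zero          f≡g = f≡g zero
    shearRow-cong (suc zero)    f≡g = f≡g (suc zero)
    shearRow-cong {α} {β} (suc (suc i)) f≡g =
      cong₂ _+_ (cong (α i *_) (f≡g zero))
                (cong₂ _+_ (cong (β i *_) (f≡g (suc zero))) (f≡g (suc (suc i))))

    shear-∑ˡ : ∀ α β r f → ∑ (λ l → shear α β r l * f l) ≡ shearRow α β r f
    shear-∑ˡ α β zero          f = ∑-idMat zero f
    shear-∑ˡ α β (suc zero)    f = ∑-idMat (suc zero) f
    shear-∑ˡ α β (suc (suc i)) f =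
      cong (λ t → α i * f zero + (β i * f (suc zero) + t)) (∑-idMat i (λ l → f (suc (suc l))))

    shear-∑ʳ : ∀ α β r f → ∑ (λ l → f l * shear α β r l) ≡ shearRow α β r f
    shear-∑ʳ α β r f = trans (∑-cong (λ l → *-comm (f l) (shear α β r l))) (shear-∑ˡ α β r f)

    shear-conj : ∀ α β (N : Mat ℕ (suc (suc k))) r s →
      (shear α β ⊗ N ⊗ shear α β ᵀ) r s ≡ shearRow α β s (λ l → shearRow α β r (λ l′ → N l′ l))
    shear-conj α β N r s = trans (shear-∑ʳ α β s (λ l → (shear α β ⊗ N) r l))
                                 (shearRow-cong s (λ l → shear-∑ˡ α β r (λ l′ → N l′ l)))

    shear-⊗-shear : ∀ α β α′ β′ r s →
      (shear α β ⊗ shear α′ β′) r s ≡ shear (λ i → α i + α′ i) (λ i → β i + β′ i) r s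
    shear-⊗-shear α β α′ β′ r s = trans (shear-∑ˡ α β r (λ l → shear α′ β′ l s)) (rows r s)
      where
      picks-first : ∀ a b c → a * 1 + (b * 0 + c) ≡ a + c
      picks-first = solve-∀
      picks-second : ∀ a b c → a * 0 + (b * 1 + c) ≡ b + c
      picks-second = solve-∀
      picks-last : ∀ a b c → a * 0 + (b * 0 + c) ≡ c
      picks-last = solve-∀
      rows : ∀ r s → shearRow α β r (λ l → shear α′ β′ l s)
                       ≡ shear (λ i → α i + α′ i) (λ i → β i + β′ i) r s
      rows zero          s             = refl
      rows (suc zero)    s             = refl
      rows (suc (suc i)) zero          = picks-first (α i) (β i) (α′ i)
      rows (suc (suc i)) (suc zero)    = picks-second (α i) (β i) (β′ i)
      rows (suc (suc i)) (suc (suc j)) = picks-last (α i) (β i) (idMat i j)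

    shear-≡-idMat : ∀ n .{{_ : NonZero n}} α β →
                    (∀ i → α i ≡ 0 [mod n ]) → (∀ i → β i ≡ 0 [mod n ]) →
                    ∀ r s → shear α β r s ≡ idMat r s [mod n ]
    shear-≡-idMat n α β α≡0 β≡0 zero          s             = refl
    shear-≡-idMat n α β α≡0 β≡0 (suc zero)    s             = refl
    shear-≡-idMat n α β α≡0 β≡0 (suc (suc i)) zero          = α≡0 i
    shear-≡-idMat n α β α≡0 β≡0 (suc (suc i)) (suc zero)    = β≡0 i
    shear-≡-idMat n α β α≡0 β≡0 (suc (suc i)) (suc (suc j)) = refl

    -- Every shear is invertible modulo n ≥ 1: an inverse is the shear by (n − 1)Γ, since
    -- Γ + (n − 1)Γ = nΓ ≡ 0.
    shear-invertible : ∀ n .{{_ : NonZero n}} α β → InvertibleMod n (shear α β)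
    shear-invertible (suc K) α β = shear (λ i → K * α i) (λ i → K * β i) , λ r s →
      trans (cong (modN (suc K)) (shear-⊗-shear α β _ _ r s))
            (shear-≡-idMat (suc K) _ _ (λ i → multiple≡0 (α i)) (λ i → multiple≡0 (β i)) r s)
      where
      multiple≡0 : ∀ a → suc K * a ≡ 0 [mod suc K ]
      multiple≡0 a = n∣m⇒m%n≡0 _ (suc K) (m∣m*n a)

    borderTerm : (α β : Fin k → ℕ) → Mat ℕ (suc (suc k)) → Fin k → Fin k → ℕ
    borderTerm α β N i j =
      α j * shearRow α β (suc (suc i)) (λ l → N l zero) +
      (β j * shearRow α β (suc (suc i)) (λ l → N l (suc zero)) +
       (α i * N zero (suc (suc j)) + β i * N (suc zero) (suc (suc j))))

    shear-conj-lower : ∀ α β (N : Mat ℕ (suc (suc k))) i j →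
      (shear α β ⊗ N ⊗ shear α β ᵀ) (suc (suc i)) (suc (suc j))
        ≡ borderTerm α β N i j + N (suc (suc i)) (suc (suc j))
    shear-conj-lower α β N i j = trans (shear-conj α β N (suc (suc i)) (suc (suc j))) (regroup
        (α j * shearRow α β (suc (suc i)) (λ l → N l zero))
        (β j * shearRow α β (suc (suc i)) (λ l → N l (suc zero)))
        (α i * N zero (suc (suc j))) (β i * N (suc zero) (suc (suc j)))
        (N (suc (suc i)) (suc (suc j))))
      where
      regroup : ∀ a b c d e → a + (b + (c + (d + e))) ≡ (a + (b + (c + d))) + e
      regroup = solve-∀

    shear-clears-border : ∀ n α β (N : Mat ℕ (suc (suc k))) → (∀ r c → N r c ≡ N c r) →
      (∀ i → α i * N zero zero + (β i * N zero (suc zero) + N (suc (suc i)) zero) ≡ 0 [mod n ]) →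
      (∀ i → α i * N zero (suc zero) + (β i * N (suc zero) (suc zero) + N (suc (suc i)) (suc zero))
               ≡ 0 [mod n ]) →
      let C = shear α β ⊗ N ⊗ shear α β ᵀ in
      (∀ i → C zero (suc (suc i)) ≡ 0 [mod n ]) × (∀ i → C (suc zero) (suc (suc i)) ≡ 0 [mod n ]) ×
      (∀ i → C (suc (suc i)) zero ≡ 0 [mod n ]) × (∀ i → C (suc (suc i)) (suc zero) ≡ 0 [mod n ])
    shear-clears-border n α β N N-sym first second =
      (λ i → via (trans (shear-conj α β N zero (suc (suc i)))
                        (cong (λ t → α i * N zero zero + (β i * N zero (suc zero) + t))
                              (N-sym zero (suc (suc i)))))
                 (first i)) ,
      (λ i → via (trans (shear-conj α β N (suc zero) (suc (suc i)))
                        (cong₂ (λ s t → α i * s + (β i * N (suc zero) (suc zero) + t))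
                               (N-sym (suc zero) zero) (N-sym (suc zero) (suc (suc i)))))
                 (second i)) ,
      (λ i → via (trans (shear-conj α β N (suc (suc i)) zero)
                        (cong (λ s → α i * N zero zero + (β i * s + N (suc (suc i)) zero))
                              (N-sym (suc zero) zero)))
                 (first i)) ,
      (λ i → via (shear-conj α β N (suc (suc i)) (suc zero)) (second i))
      where
      via : ∀ {x y} → x ≡ y → y ≡ 0 [mod n ] → x ≡ 0 [mod n ]
      via x≡y y≡0 = trans (cong (modN n) x≡y) y≡0

module IntegerCongruences where

  open import Data.Nat as ℕ using (zero)
  open import Data.Nat.DivMod using ([m+kn]%n≡m%n)
  open import Data.Integer using (ℤ; +_; -[1+_]; _+_; _*_; -_; _-_; _%ℕ_; _/ℕ_)
  open import Data.Integer.DivMod using (a≡a%ℕn+[a/ℕn]*n)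
  import Data.Integer.Properties as ℤP
  open import Data.Integer.Divisibility.Signed
    using (_∣_; divides; ∣m∣n⇒∣m+n; ∣m⇒∣-m; ∣m⇒∣m*n; ∣n⇒∣m*n)
  open import Data.Integer.Tactic.RingSolver using (solve-∀)
  open import Relation.Binary.Bundles using (Setoid)
  import Relation.Binary.Reasoning.Setoid as SetoidReasoning
  open import Relation.Binary.PropositionalEquality
    using (refl; sym; trans; cong; cong₂; subst; module ≡-Reasoning)

  -- Congruence of integers modulo n: n divides the difference.  (A record rather than a
  -- synonym, so that x and y can be inferred from a proof.)
  record _≡ᶻ_[mod_] (x y : ℤ) (n : ℕ) : Set where
    constructor divides-difference
    field n∣x-y : + n ∣ x - y

  infix 4 _≡ᶻ_[mod_]

  module _ {n : ℕ} where

    ≡ᶻ-reflexive : ∀ {x y} → x ≡ y → x ≡ᶻ y [mod n ]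
    ≡ᶻ-reflexive {x} refl = divides-difference (divides (+ 0) (ℤP.+-inverseʳ x))

    ≡ᶻ-refl : ∀ {x} → x ≡ᶻ x [mod n ]
    ≡ᶻ-refl = ≡ᶻ-reflexive refl

    ≡ᶻ-sym : ∀ {x y} → x ≡ᶻ y [mod n ] → y ≡ᶻ x [mod n ]
    ≡ᶻ-sym {x} {y} (divides-difference d) =
      divides-difference (subst (+ n ∣_) (swap x y) (∣m⇒∣-m d))
      where
      swap : ∀ x y → - (x - y) ≡ y - x
      swap = solve-∀

    ≡ᶻ-trans : ∀ {x y z} → x ≡ᶻ y [mod n ] → y ≡ᶻ z [mod n ] → x ≡ᶻ z [mod n ]
    ≡ᶻ-trans {x} {y} {z} (divides-difference d) (divides-difference e) =
      divides-difference (subst (+ n ∣_) (telescope x y z) (∣m∣n⇒∣m+n d e))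
      where
      telescope : ∀ x y z → (x - y) + (y - z) ≡ x - z
      telescope = solve-∀

    +-cong : ∀ {x x′ y y′} → x ≡ᶻ x′ [mod n ] → y ≡ᶻ y′ [mod n ] →
             x + y ≡ᶻ x′ + y′ [mod n ]
    +-cong {x} {x′} {y} {y′} (divides-difference d) (divides-difference e) =
      divides-difference (subst (+ n ∣_) (regroup x x′ y y′) (∣m∣n⇒∣m+n d e))
      where
      regroup : ∀ x x′ y y′ → (x - x′) + (y - y′) ≡ (x + y) - (x′ + y′)
      regroup = solve-∀

    *-cong : ∀ {x x′ y y′} → x ≡ᶻ x′ [mod n ] → y ≡ᶻ y′ [mod n ] →
             x * y ≡ᶻ x′ * y′ [mod n ]
    *-cong {x} {x′} {y} {y′} (divides-difference d) (divides-difference e) =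
      divides-difference
        (subst (+ n ∣_) (regroup x x′ y y′) (∣m∣n⇒∣m+n (∣m⇒∣m*n y d) (∣n⇒∣m*n x′ e)))
      where
      regroup : ∀ x x′ y y′ → (x - x′) * y + x′ * (y - y′) ≡ x * y - x′ * y′
      regroup = solve-∀

    neg-cong : ∀ {x x′} → x ≡ᶻ x′ [mod n ] → - x ≡ᶻ - x′ [mod n ]
    neg-cong {x} {x′} (divides-difference d) =
      divides-difference (subst (+ n ∣_) (regroup x x′) (∣m⇒∣-m d))
      where
      regroup : ∀ x x′ → - (x - x′) ≡ - x - - x′
      regroup = solve-∀

  ℤmod : ℕ → Setoid _ _
  ℤmod n = record
    { Carrier = ℤ
    ; _≈_ = _≡ᶻ_[mod n ]
    ; isEquivalence = record { refl = ≡ᶻ-refl ; sym = ≡ᶻ-sym ; trans = ≡ᶻ-trans }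
    }

  residue : ∀ n .{{_ : NonZero n}} → ℤ → ℕ
  residue n z = z %ℕ n

  residue-≡ᶻ : ∀ n .{{_ : NonZero n}} z → + residue n z ≡ᶻ z [mod n ]
  residue-≡ᶻ n z = divides-difference (divides (- (z /ℕ n)) (begin
      + r - z                       ≡⟨ cong (_-_ (+ r)) (a≡a%ℕn+[a/ℕn]*n z n) ⟩
      + r - (+ r + z /ℕ n * + n)    ≡⟨ cancel (+ r) (z /ℕ n) (+ n) ⟩
      - (z /ℕ n) * + n              ∎))
    where
    open ≡-Reasoning
    r : ℕ
    r = residue n z
    cancel : ∀ r q n → r - (r + q * n) ≡ - q * n
    cancel = solve-∀

  pos-+-* : ∀ a b c → + (a ℕ.+ b ℕ.* c) ≡ + a + + b * + c
  pos-+-* a b c = trans (ℤP.pos-+ a (b ℕ.* c)) (cong (_+_ (+ a)) (ℤP.pos-* b c))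

  pos-row : ∀ α a β b x → + (α ℕ.* a ℕ.+ (β ℕ.* b ℕ.+ x)) ≡ + α * + a + (+ β * + b + + x)
  pos-row α a β b x = trans (ℤP.pos-+ (α ℕ.* a) _)
    (cong₂ _+_ (ℤP.pos-* α a) (trans (ℤP.pos-+ (β ℕ.* b) x) (cong (_+ + x) (ℤP.pos-* β b))))

  difference⇒sum : ∀ x y j n → + x - + y ≡ + j * + n → x ≡ y ℕ.+ j ℕ.* n
  difference⇒sum x y j n e = ℤP.+-injective (begin
      + x                       ≡⟨ rearrange (+ x) (+ y) ⟩
      + y + (+ x - + y)         ≡⟨ cong (_+_ (+ y)) (trans e (sym (ℤP.pos-* j n))) ⟩
      + y + + (j ℕ.* n)         ≡⟨ ℤP.pos-+ y (j ℕ.* n) ⟨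
      + (y ℕ.+ j ℕ.* n)         ∎)
    where
    open ≡-Reasoning
    rearrange : ∀ a b → a ≡ b + (a - b)
    rearrange = solve-∀

  ≡[mod]⇒≡ᶻ : ∀ {x y} n → x ≡ y [mod n ] → + x ≡ᶻ + y [mod n ]
  ≡[mod]⇒≡ᶻ zero    x≡y = ≡ᶻ-reflexive (cong +_ x≡y)
  ≡[mod]⇒≡ᶻ {x} {y} (suc k) x%n≡y%n = begin
      + x                 ≈⟨ residue-≡ᶻ (suc k) (+ x) ⟨
      + (x ℕ.% suc k)     ≡⟨ cong +_ x%n≡y%n ⟩
      + (y ℕ.% suc k)     ≈⟨ residue-≡ᶻ (suc k) (+ y) ⟩
      + y                 ∎
    where open SetoidReasoning (ℤmod (suc k))

  -- Conversely, split on the sign of the quotient and add the multiple on the smaller side.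
  ≡ᶻ⇒≡[mod] : ∀ {x y} n → + x ≡ᶻ + y [mod n ] → x ≡ y [mod n ]
  ≡ᶻ⇒≡[mod] zero (divides-difference (divides q e)) =
    ℤP.+-injective (ℤP.i-j≡0⇒i≡j (+ _) (+ _) (trans e (ℤP.*-zeroʳ q)))
  ≡ᶻ⇒≡[mod] {x} {y} (suc k) (divides-difference (divides (+ j) e)) = begin
      x ℕ.% suc k                       ≡⟨ cong (ℕ._% suc k) (difference⇒sum x y j (suc k) e) ⟩
      (y ℕ.+ j ℕ.* suc k) ℕ.% suc k     ≡⟨ [m+kn]%n≡m%n y j (suc k) ⟩
      y ℕ.% suc k                       ∎
    where open ≡-Reasoning
  ≡ᶻ⇒≡[mod] {x} {y} (suc k) (divides-difference (divides -[1+ j ] e)) = begin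
      x ℕ.% suc k                       ≡⟨ [m+kn]%n≡m%n x (suc j) (suc k) ⟨
      (x ℕ.+ suc j ℕ.* suc k) ℕ.% suc k ≡⟨ cong (ℕ._% suc k) (difference⇒sum y x (suc j) (suc k) e′) ⟨
      y ℕ.% suc k                       ∎
    where
    open ≡-Reasoning
    swap : ∀ a b → b - a ≡ - (a - b)
    swap = solve-∀
    e′ : + y - + x ≡ + suc j * + suc k
    e′ = trans (swap (+ x) (+ y)) (trans (cong -_ e) (ℤP.neg-distribˡ-* -[1+ j ] (+ suc k)))

  ≡0[mod]⇒∣ : ∀ {x} n → x ≡ 0 [mod n ] → + n ∣ + x
  ≡0[mod]⇒∣ {x} n x≡0 =
    subst (+ n ∣_) (ℤP.+-identityʳ (+ x)) (_≡ᶻ_[mod_].n∣x-y (≡[mod]⇒≡ᶻ n x≡0))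

  ∣⇒≡0[mod] : ∀ {x} n → + n ∣ + x → x ≡ 0 [mod n ]
  ∣⇒≡0[mod] {x} n n∣x =
    ≡ᶻ⇒≡[mod] n (divides-difference (subst (+ n ∣_) (sym (ℤP.+-identityʳ (+ x))) n∣x))

module Units where

  open IntegerCongruences
  open import Data.Nat as ℕ using (zero)
  import Data.Nat.Properties as ℕP
  open import Data.Nat.Divisibility as ℕ∣ using (∣1⇒≡1)
  open import Data.Nat.Coprimality using (Coprime; coprime-divisor; coprime⇒GCD≡1)
  open import Data.Nat.GCD using (module GCD; module Bézout)
  open import Data.Nat.Primality using (prime⇒irreducible; euclidsLemma)
  open import Data.Integer as ℤ using (ℤ; +_; -[1+_]; _+_; _*_; -_; _-_)
  import Data.Integer.Properties as ℤP
  open import Data.Integer.Divisibility.Signed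
    using (_∣_; divides; ∣ᵤ⇒∣; ∣⇒∣ᵤ; ∣m∣n⇒∣m-n; ∣m⇒∣m*n)
  open import Data.Integer.Tactic.RingSolver using (solve-∀)
  open import Data.Sum using (inj₁; inj₂; [_,_]′)
  open import Data.Empty using (⊥-elim)
  open import Function using (id)
  open import Relation.Binary.PropositionalEquality
    using (refl; trans; cong; subst; module ≡-Reasoning)

  bézout-coefficient : ∀ {d n m} → Bézout.Identity d n m → ℤ
  bézout-coefficient (Bézout.+- x y _) = - + y
  bézout-coefficient (Bézout.-+ x y _) = + y

  bézout-coefficient-spec : ∀ {d n m} (b : Bézout.Identity d n m) →
                            + m * bézout-coefficient b ≡ᶻ + d [mod n ]
  bézout-coefficient-spec {d} {n} {m} (Bézout.+- x y eq) =
    divides-difference (divides (- + x) (begin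
      + m * - + y - + d      ≡⟨ regroup (+ m) (+ y) (+ d) ⟩
      - (+ d + + y * + m)    ≡⟨ cong -_ (pos-+-* d y m) ⟨
      - + (d ℕ.+ y ℕ.* m)    ≡⟨ cong (λ t → - + t) eq ⟩
      - + (x ℕ.* n)          ≡⟨ cong -_ (ℤP.pos-* x n) ⟩
      - (+ x * + n)          ≡⟨ ℤP.neg-distribˡ-* (+ x) (+ n) ⟩
      - + x * + n            ∎))
    where
    open ≡-Reasoning
    regroup : ∀ m y d → m * - y - d ≡ - (d + y * m)
    regroup = solve-∀
  bézout-coefficient-spec {d} {n} {m} (Bézout.-+ x y eq) =
    divides-difference (divides (+ x) (begin
      + m * + y - + d          ≡⟨ cong (_- + d) (trans (ℤP.pos-* y m) (ℤP.*-comm (+ y) (+ m))) ⟨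
      + (y ℕ.* m) - + d        ≡⟨ cong (λ t → + t - + d) eq ⟨
      + (d ℕ.+ x ℕ.* n) - + d  ≡⟨ cong (_- + d) (pos-+-* d x n) ⟩
      + d + + x * + n - + d    ≡⟨ cancel (+ d) (+ x * + n) ⟩
      + x * + n                ∎))
    where
    open ≡-Reasoning
    cancel : ∀ a b → a + b - a ≡ b
    cancel = solve-∀

  lemma-coefficient : ∀ {n m} → Bézout.Lemma n m → ℤ
  lemma-coefficient (Bézout.result _ _ b) = bézout-coefficient b

  inverseℕ : ℕ → ℕ → ℤ
  inverseℕ n m = lemma-coefficient (Bézout.lemma n m)

  inverseℕ-spec : ∀ {n m} → Coprime n m → + m * inverseℕ n m ≡ᶻ + 1 [mod n ]
  inverseℕ-spec {n} {m} coprime = spec (Bézout.lemma n m)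
    where
    spec : (L : Bézout.Lemma n m) → + m * lemma-coefficient L ≡ᶻ + 1 [mod n ]
    spec (Bézout.result d g b) =
      subst (λ e → + m * bézout-coefficient b ≡ᶻ + e [mod n ])
            (GCD.unique g (coprime⇒GCD≡1 coprime)) (bézout-coefficient-spec b)

  inverse : ℕ → ℤ → ℤ
  inverse n (+ m)    = inverseℕ n m
  inverse n -[1+ m ] = - inverseℕ n (suc m)

  inverse-spec : ∀ {n} z → Coprime n ℤ.∣ z ∣ → z * inverse n z ≡ᶻ + 1 [mod n ]
  inverse-spec (+ m)    coprime = inverseℕ-spec coprime
  inverse-spec -[1+ m ] coprime =
    ≡ᶻ-trans (≡ᶻ-reflexive (neg*neg (+ suc m) _)) (inverseℕ-spec coprime)
    where
    neg*neg : ∀ a b → (- a) * (- b) ≡ a * b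
    neg*neg = solve-∀

  prime∤⇒coprime : ∀ {p m} → Prime p → ¬ p ℕ∣.∣ m → Coprime p m
  prime∤⇒coprime isPrime p∤m (d∣p , d∣m) with prime⇒irreducible isPrime d∣p
  ... | inj₁ d≡1  = d≡1
  ... | inj₂ refl = ⊥-elim (p∤m d∣m)

  coprime-* : ∀ {a b m} → Coprime a m → Coprime b m → Coprime (a ℕ.* b) m
  coprime-* {a} {b} a⊥m b⊥m {d} (d∣ab , d∣m) = a⊥m (d∣a , d∣m)
    where
    d⊥b : Coprime d b
    d⊥b (e∣d , e∣b) = b⊥m (e∣b , ℕ∣.∣-trans e∣d d∣m)
    d∣a : d ℕ∣.∣ a
    d∣a = coprime-divisor d⊥b (subst (d ℕ∣.∣_) (ℕP.*-comm a b) d∣ab)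

  coprime-^ : ∀ {a m} k → Coprime a m → Coprime (a ℕ.^ k) m
  coprime-^ zero    a⊥m (d∣1 , _) = ∣1⇒≡1 d∣1
  coprime-^ (suc k) a⊥m = coprime-* a⊥m (coprime-^ k a⊥m)

  unit-mod-prime-power : ∀ {p} μ z → Prime p → ¬ (+ p ∣ z) →
                         z * inverse (p ℕ.^ μ) z ≡ᶻ + 1 [mod p ℕ.^ μ ]
  unit-mod-prime-power μ z isPrime p∤z =
    inverse-spec z (coprime-^ μ (prime∤⇒coprime isPrime (λ p∣z → p∤z (∣ᵤ⇒∣ p∣z))))

  det-not-divisible : ∀ {p} a b c → Prime p → + p ∣ a → ¬ (+ p ∣ b) →
                      ¬ (+ p ∣ a * c - b * b)
  det-not-divisible {p} a b c isPrime p∣a p∤b p∣det =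
    p∤b (∣ᵤ⇒∣ ([ id , id ]′ (euclidsLemma _ _ isPrime p∣b²)))
    where
    b²≡ : ∀ a b c → a * c - (a * c - b * b) ≡ b * b
    b²≡ = solve-∀
    p∣b² : p ℕ∣.∣ ℤ.∣ b ∣ ℕ.* ℤ.∣ b ∣
    p∣b² = subst (p ℕ∣.∣_) (ℤP.abs-* b b)
      (∣⇒∣ᵤ (subst (+ p ∣_) (b²≡ a b c) (∣m∣n⇒∣m-n (∣m⇒∣m*n c p∣a) p∣det)))

module Elimination where

  open Shears
  open IntegerCongruences
  open Units
  open import Data.Nat as ℕ using (zero)
  open import Data.Integer using (ℤ; +_; _+_; _*_; -_; _-_)
  import Data.Integer.Properties as ℤP
  open import Data.Integer.Tactic.RingSolver using (solve-∀)
  open import Data.Product using (proj₁; proj₂)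
  import Relation.Binary.Reasoning.Setoid as SetoidReasoning
  open import Relation.Binary.PropositionalEquality using (refl; cong)

  -- Eliminating a border row (x , y) against a symmetric block (a b ; b c) whose
  -- determinant d = a c − b² has an inverse w:  α = (b y − c x) w,  β = (b x − a y) w
  -- solve  α a + β b + x ≡ 0  and  α b + β c + y ≡ 0.
  elim-α elim-β : (w a b c x y : ℤ) → ℤ
  elim-α w a b c x y = (b * y - c * x) * w
  elim-β w a b c x y = (b * x - a * y) * w

  eliminates : ∀ {n} w a b c x y → (a * c - b * b) * w ≡ᶻ + 1 [mod n ] →
    (elim-α w a b c x y * a + (elim-β w a b c x y * b + x) ≡ᶻ + 0 [mod n ]) ×
    (elim-α w a b c x y * b + (elim-β w a b c x y * c + y) ≡ᶻ + 0 [mod n ])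
  eliminates {n} w a b c x y dw≡1 =
    (begin
      elim-α w a b c x y * a + (elim-β w a b c x y * b + x) ≡⟨ first-row w a b c x y ⟩
      x * (+ 1 - (a * c - b * b) * w)                         ≈⟨ vanishes x ⟩
      + 0                                                     ∎) ,
    (begin
      elim-α w a b c x y * b + (elim-β w a b c x y * c + y) ≡⟨ second-row w a b c x y ⟩
      y * (+ 1 - (a * c - b * b) * w)                         ≈⟨ vanishes y ⟩
      + 0                                                     ∎)
    where
    open SetoidReasoning (ℤmod n)
    first-row : ∀ w a b c x y →
      (b * y - c * x) * w * a + ((b * x - a * y) * w * b + x) ≡ x * (+ 1 - (a * c - b * b) * w)
    first-row = solve-∀
    second-row : ∀ w a b c x y →
      (b * y - c * x) * w * b + ((b * x - a * y) * w * c + y) ≡ y * (+ 1 - (a * c - b * b) * w)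
    second-row = solve-∀
    vanishes : ∀ t → t * (+ 1 - (a * c - b * b) * w) ≡ᶻ + 0 [mod n ]
    vanishes t = begin
      t * (+ 1 - (a * c - b * b) * w)
        ≈⟨ *-cong (≡ᶻ-refl {x = t}) (+-cong (≡ᶻ-refl {x = + 1}) (neg-cong dw≡1)) ⟩
      t * (+ 1 - + 1)
        ≡⟨ ℤP.*-zeroʳ t ⟩
      + 0 ∎

  det : ∀ {k} → Mat ℕ (suc (suc k)) → ℤ
  det N = + N zero zero * + N (suc zero) (suc zero)
        - + N zero (suc zero) * + N zero (suc zero)

  module Clearing (n : ℕ) .{{_ : NonZero n}} where

    coefficients : (a b c x y : ℕ) → ℕ × ℕ
    coefficients a b c x y = residue n (elim-α w (+ a) (+ b) (+ c) (+ x) (+ y)) ,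
                              residue n (elim-β w (+ a) (+ b) (+ c) (+ x) (+ y))
      where
      w : ℤ
      w = inverse n (+ a * + c - + b * + b)

    coefficients-eliminate : ∀ a b c x y →
      (+ a * + c - + b * + b) * inverse n (+ a * + c - + b * + b) ≡ᶻ + 1 [mod n ] →
      let (α , β) = coefficients a b c x y in
      (α ℕ.* a ℕ.+ (β ℕ.* b ℕ.+ x) ≡ 0 [mod n ]) × (α ℕ.* b ℕ.+ (β ℕ.* c ℕ.+ y) ≡ 0 [mod n ])
    coefficients-eliminate a b c x y unit =
      ≡ᶻ⇒≡[mod] n (reduce a b x (proj₁ (eliminates w (+ a) (+ b) (+ c) (+ x) (+ y) unit))) ,
      ≡ᶻ⇒≡[mod] n (reduce b c y (proj₂ (eliminates w (+ a) (+ b) (+ c) (+ x) (+ y) unit)))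
      where
      w αᶻ βᶻ : ℤ
      w = inverse n (+ a * + c - + b * + b)
      αᶻ = elim-α w (+ a) (+ b) (+ c) (+ x) (+ y)
      βᶻ = elim-β w (+ a) (+ b) (+ c) (+ x) (+ y)
      reduce : ∀ s t u → αᶻ * + s + (βᶻ * + t + + u) ≡ᶻ + 0 [mod n ] →
               + (residue n αᶻ ℕ.* s ℕ.+ (residue n βᶻ ℕ.* t ℕ.+ u)) ≡ᶻ + 0 [mod n ]
      reduce s t u eliminated = begin
        + (residue n αᶻ ℕ.* s ℕ.+ (residue n βᶻ ℕ.* t ℕ.+ u))
          ≡⟨ pos-row (residue n αᶻ) s (residue n βᶻ) t u ⟩
        + residue n αᶻ * + s + (+ residue n βᶻ * + t + + u)
          ≈⟨ +-cong (*-cong (residue-≡ᶻ n αᶻ) ≡ᶻ-refl)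
                    (+-cong (*-cong (residue-≡ᶻ n βᶻ) ≡ᶻ-refl) ≡ᶻ-refl) ⟩
        αᶻ * + s + (βᶻ * + t + + u)
          ≈⟨ eliminated ⟩
        + 0 ∎
        where open SetoidReasoning (ℤmod n)

    module _ {k : ℕ} where

      rowCoefficients : Mat ℕ (suc (suc k)) → Fin k → ℕ × ℕ
      rowCoefficients N i = coefficients (N zero zero) (N zero (suc zero)) (N (suc zero) (suc zero))
                                         (N (suc (suc i)) zero) (N (suc (suc i)) (suc zero))

      αs βs : Mat ℕ (suc (suc k)) → Fin k → ℕ
      αs N i = proj₁ (rowCoefficients N i)
      βs N i = proj₂ (rowCoefficients N i)

      clearingShear : Mat ℕ (suc (suc k)) → Mat ℕ (suc (suc k))
      clearingShear N = shear (αs N) (βs N)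

      rowCoefficients-eliminate : ∀ N i → det N * inverse n (det N) ≡ᶻ + 1 [mod n ] →
        (αs N i ℕ.* N zero zero ℕ.+ (βs N i ℕ.* N zero (suc zero) ℕ.+ N (suc (suc i)) zero)
           ≡ 0 [mod n ]) ×
        (αs N i ℕ.* N zero (suc zero) ℕ.+
           (βs N i ℕ.* N (suc zero) (suc zero) ℕ.+ N (suc (suc i)) (suc zero)) ≡ 0 [mod n ])
      rowCoefficients-eliminate N i = coefficients-eliminate
        (N zero zero) (N zero (suc zero)) (N (suc zero) (suc zero))
        (N (suc (suc i)) zero) (N (suc (suc i)) (suc zero))

      clearingShear-clears-border : ∀ N → (∀ r c → N r c ≡ N c r) →
        det N * inverse n (det N) ≡ᶻ + 1 [mod n ] →
        let C = clearingShear N ⊗ N ⊗ clearingShear N ᵀ in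
        (∀ i → C zero (suc (suc i)) ≡ 0 [mod n ]) × (∀ i → C (suc zero) (suc (suc i)) ≡ 0 [mod n ]) ×
        (∀ i → C (suc (suc i)) zero ≡ 0 [mod n ]) × (∀ i → C (suc (suc i)) (suc zero) ≡ 0 [mod n ])
      clearingShear-clears-border N N-sym unit = shear-clears-border n _ _ N N-sym
        (λ i → proj₁ (rowCoefficients-eliminate N i unit))
        (λ i → proj₂ (rowCoefficients-eliminate N i unit))

      clearingShear-cong : ∀ {N N′} → (∀ r c → N r c ≡ N′ r c) →
                           ∀ r c → clearingShear N r c ≡ clearingShear N′ r c
      clearingShear-cong {N} {N′} N≡N′ =
        shear-cong (λ i → cong proj₁ (same-row i)) (λ i → cong proj₂ (same-row i))
        where
        same-row : ∀ i → rowCoefficients N i ≡ rowCoefficients N′ i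
        same-row i rewrite N≡N′ zero zero | N≡N′ zero (suc zero) | N≡N′ (suc zero) (suc zero)
                         | N≡N′ (suc (suc i)) zero | N≡N′ (suc (suc i)) (suc zero) = refl

module Counting where

  open IntegerCongruences using (_≡ᶻ_[mod_]; ≡ᶻ-reflexive; ≡ᶻ-refl; +-cong; ℤmod; ≡[mod]⇒≡ᶻ)
  open import Data.Nat using (zero; _+_)
  import Data.Nat.Properties as ℕP
  open import Data.Nat.DivMod using (n%n≡0)
  open import Data.Nat.Tactic.RingSolver using (solve-∀)
  open import Data.Integer as ℤ using (+_)
  open import Data.Fin using (punchIn)
  open import Data.Fin.Properties using (punchIn-injective; punchInᵢ≢i)
  open import Data.List
    using (List; []; _∷_; map; concat; concatMap; filter; length; tabulate; allFin; _++_)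
  open import Data.Bool using (if_then_else_)
  open import Data.Sum using (_⊎_; inj₁; inj₂)
  open import Data.Empty using (⊥-elim)
  open import Function using (_∘_; id)
  open import Level using (0ℓ)
  open import Relation.Binary.Bundles using (Setoid)
  open import Relation.Nullary using (Dec; does; yes; no)
  import Relation.Binary.Reasoning.Setoid as SetoidReasoning
  open import Relation.Binary.PropositionalEquality
    using (refl; sym; trans; cong; cong₂; subst₂; module ≡-Reasoning)
    renaming (setoid to ≡-setoid)
  import Data.Vec.Functional.Relation.Binary.Equality.Setoid as Pointwise

  total : ∀ {X : Set} → (X → ℕ) → List X → ℕ
  total g []       = 0
  total g (x ∷ xs) = g x + total g xs

  total-cong : ∀ {X : Set} {g h : X → ℕ} xs → (∀ x → g x ≡ h x) →
               total g xs ≡ total h xs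
  total-cong []       g≡h = refl
  total-cong (x ∷ xs) g≡h = cong₂ _+_ (g≡h x) (total-cong xs g≡h)

  total-++ : ∀ {X : Set} (g : X → ℕ) xs ys → total g (xs ++ ys) ≡ total g xs + total g ys
  total-++ g []       ys = refl
  total-++ g (x ∷ xs) ys =
    trans (cong (_+_ (g x)) (total-++ g xs ys)) (sym (ℕP.+-assoc (g x) _ _))

  total-concatMap : ∀ {X Y : Set} (g : Y → ℕ) (F : X → List Y) xs →
                    total g (concatMap F xs) ≡ total (λ x → total g (F x)) xs
  total-concatMap g F []       = refl
  total-concatMap g F (x ∷ xs) = trans (total-++ g (F x) (concat (map F xs)))
                                       (cong (_+_ (total g (F x))) (total-concatMap g F xs))

  total-map : ∀ {X Y : Set} (g : Y → ℕ) (h : X → Y) xs →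
              total g (map h xs) ≡ total (g ∘ h) xs
  total-map g h []       = refl
  total-map g h (x ∷ xs) = cong (_+_ (g (h x))) (total-map g h xs)

  total-tabulate : ∀ {k} {X : Set} (g : X → ℕ) (h : Fin k → X) →
                   total g (tabulate h) ≡ ∑ (g ∘ h)
  total-tabulate {zero}  g h = refl
  total-tabulate {suc k} g h = cong (_+_ (g (h zero))) (total-tabulate g (h ∘ suc))

  indicator : ∀ {X : Set} {P : X → Set} → (∀ x → Dec (P x)) → X → ℕ
  indicator P? x = if does (P? x) then 1 else 0

  count≡total : ∀ {X : Set} {P : X → Set} (P? : ∀ x → Dec (P x)) xs →
                length (filter P? xs) ≡ total (indicator P?) xs
  count≡total P? []       = refl
  count≡total P? (x ∷ xs) with P? x
  ... | yes _ = cong suc (count≡total P? xs)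
  ... | no  _ = count≡total P? xs

  indicator-⇔ : ∀ {X Y : Set} {P : X → Set} {Q : Y → Set}
                (P? : ∀ x → Dec (P x)) (Q? : ∀ y → Dec (Q y)) {x y} →
                (P x → Q y) → (Q y → P x) → indicator P? x ≡ indicator Q? y
  indicator-⇔ P? Q? {x} {y} P⇒Q Q⇒P with P? x | Q? y
  ... | yes _ | yes _ = refl
  ... | no  _ | no  _ = refl
  ... | yes p | no ¬q = ⊥-elim (¬q (P⇒Q p))
  ... | no ¬p | yes q = ⊥-elim (¬p (Q⇒P q))

  -- A map σ on (the carrier of) a setoid leaves the sum over xs invariant, for every summand
  -- respecting the setoid equality.  (Functions are compared pointwise, as there is no
  -- function extensionality.)
  Invariant : (𝕊 : Setoid 0ℓ 0ℓ) → List (Setoid.Carrier 𝕊) →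
              (Setoid.Carrier 𝕊 → Setoid.Carrier 𝕊) → Set
  Invariant 𝕊 xs σ =
    ∀ (g : Carrier → ℕ) → (∀ {x y} → x ≈ y → g x ≡ g y) → total g xs ≡ total (g ∘ σ) xs
    where open Setoid 𝕊

  module _ (𝕊 : Setoid 0ℓ 0ℓ) where
    open Setoid 𝕊 using (_≈_; reflexive) renaming (Carrier to X)
    open Pointwise 𝕊 using (_≋_; ≋-setoid)

    prefix-invariant : ∀ {k} xs (L : List (Fin k → X)) (cons : X → (Fin k → X) → Fin (suc k) → X) →
      (∀ x f → cons x f zero ≡ x) → (∀ x f i → cons x f (suc i) ≡ f i) →
      (σ : Fin (suc k) → X → X) → Invariant 𝕊 xs (σ zero) →
      Invariant (≋-setoid k) L (λ f i → σ (suc i) (f i)) →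
      Invariant (≋-setoid (suc k)) (concatMap (λ x → map (cons x) L) xs) (λ f i → σ i (f i))
    prefix-invariant xs L cons head tail σ head-inv tail-inv g g-resp = begin
      total g (concatMap (λ x → map (cons x) L) xs)
        ≡⟨ split g ⟩
      total (λ x → total (g ∘ cons x) L) xs
        ≡⟨ head-inv (λ x → total (g ∘ cons x) L)
                    (λ x≈y → total-cong L (λ f → g-resp (cons-respˡ x≈y f))) ⟩
      total (λ x → total (g ∘ cons (σ zero x)) L) xs
        ≡⟨ total-cong xs (λ x → tail-inv (g ∘ cons (σ zero x)) (λ f≋f′ → g-resp (cons-respʳ f≋f′))) ⟩
      total (λ x → total (λ f → g (cons (σ zero x) (λ i → σ (suc i) (f i)))) L) xs
        ≡⟨ total-cong xs (λ x → total-cong L (λ f → g-resp (cons-σ x f))) ⟩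
      total (λ x → total (λ f → g (λ i → σ i (cons x f i))) L) xs
        ≡⟨ split (λ f → g (λ i → σ i (f i))) ⟨
      total (λ f → g (λ i → σ i (f i))) (concatMap (λ x → map (cons x) L) xs) ∎
      where
      open ≡-Reasoning
      split : ∀ h → total h (concatMap (λ x → map (cons x) L) xs)
                      ≡ total (λ x → total (h ∘ cons x) L) xs
      split h = trans (total-concatMap h _ xs) (total-cong xs (λ x → total-map h (cons x) L))
      cons-respˡ : ∀ {x y} → x ≈ y → ∀ f → cons x f ≋ cons y f
      cons-respˡ {x} {y} x≈y f zero    = subst₂ _≈_ (sym (head x f)) (sym (head y f)) x≈y
      cons-respˡ         x≈y f (suc i) = reflexive (trans (tail _ f i) (sym (tail _ f i)))
      cons-respʳ : ∀ {x f f′} → f ≋ f′ → cons x f ≋ cons x f′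
      cons-respʳ {x} {f} {f′} f≋f′ zero    = reflexive (trans (head x f) (sym (head x f′)))
      cons-respʳ {x} {f} {f′} f≋f′ (suc i) =
        subst₂ _≈_ (sym (tail x f i)) (sym (tail x f′ i)) (f≋f′ i)
      cons-σ : ∀ x f → cons (σ zero x) (λ i → σ (suc i) (f i)) ≋ (λ i → σ i (cons x f i))
      cons-σ x f zero    = reflexive (trans (head _ _) (cong (σ zero) (sym (head x f))))
      cons-σ x f (suc i) = reflexive (trans (tail _ _ i) (cong (σ (suc i)) (sym (tail x f i))))

    allFuns-invariant : ∀ k xs (σ : Fin k → X → X) → (∀ i → Invariant 𝕊 xs (σ i)) →
                        Invariant (≋-setoid k) (allFuns k xs) (λ f i → σ i (f i))
    allFuns-invariant zero    xs σ σ-inv g g-resp = cong (_+ 0) (g-resp (λ ()))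
    allFuns-invariant (suc k) xs σ σ-inv =
      prefix-invariant xs (allFuns k xs) _ (λ _ _ → refl) (λ _ _ _ → refl) σ (σ-inv zero)
        (allFuns-invariant k xs (σ ∘ suc) (σ-inv ∘ suc))

  -- The cyclic successor  x ↦ x + 1 (mod n + 1)  on Fin (suc n).  (`punchIn (suc zero)` embeds
  -- Fin (suc n) into Fin (suc (suc n)) skipping the value 1.)
  next : ∀ {n} → Fin (suc n) → Fin (suc n)
  next {zero}  zero    = zero
  next {suc n} zero    = suc zero
  next {suc n} (suc x) = punchIn (suc zero) (next x)

  next-injective : ∀ {n} {x y : Fin (suc n)} → next x ≡ next y → x ≡ y
  next-injective {zero}  {zero}  {zero}  _ = refl
  next-injective {suc n} {zero}  {zero}  _ = refl
  next-injective {suc n} {zero}  {suc y} e = ⊥-elim (punchInᵢ≢i (suc zero) (next y) (sym e))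
  next-injective {suc n} {suc x} {zero}  e = ⊥-elim (punchInᵢ≢i (suc zero) (next x) e)
  next-injective {suc n} {suc x} {suc y} e =
    cong suc (next-injective (punchIn-injective (suc zero) _ _ e))

  next-∑ : ∀ {n} (g : Fin (suc n) → ℕ) → ∑ (g ∘ next) ≡ ∑ g
  next-∑ {zero}  g = refl
  next-∑ {suc n} g = begin
      g (suc zero) + ∑ (g ∘ punchIn (suc zero) ∘ next)
        ≡⟨ cong (_+_ (g (suc zero))) (next-∑ (g ∘ punchIn (suc zero))) ⟩
      g (suc zero) + (g zero + rest)
        ≡⟨ swap (g (suc zero)) (g zero) rest ⟩
      g zero + (g (suc zero) + rest) ∎
    where
    open ≡-Reasoning
    rest : ℕ
    rest = ∑ (λ z → g (suc (suc z)))
    swap : ∀ a b c → a + (b + c) ≡ b + (a + c)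
    swap = solve-∀

  next-toℕ : ∀ {n} (x : Fin (suc n)) →
             (toℕ (next x) ≡ suc (toℕ x)) ⊎ (toℕ (next x) ≡ 0 × suc (toℕ x) ≡ suc n)
  next-toℕ {zero}  zero    = inj₂ (refl , refl)
  next-toℕ {suc n} zero    = inj₁ refl
  next-toℕ {suc n} (suc x) with next x | next-toℕ x
  ... | zero  | inj₂ (_ , top) = inj₂ (refl , cong suc top)
  ... | suc y | inj₁ e         = inj₁ (cong suc e)
  ... | zero  | inj₁ ()
  ... | suc y | inj₂ (() , _)

  next-≡ : ∀ {n} (x : Fin (suc n)) → toℕ (next x) ≡ suc (toℕ x) [mod suc n ]
  next-≡ {n} x with next-toℕ x
  ... | inj₁ e         = cong (modN (suc n)) e
  ... | inj₂ (e , top) =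
    trans (cong (modN (suc n)) e) (trans (sym (n%n≡0 (suc n))) (cong (modN (suc n)) (sym top)))

  shift : ∀ {n} → ℕ → Fin (suc n) → Fin (suc n)
  shift zero    x = x
  shift (suc d) x = next (shift d x)

  shift-∑ : ∀ {n} d (g : Fin (suc n) → ℕ) → ∑ (g ∘ shift d) ≡ ∑ g
  shift-∑ zero    g = refl
  shift-∑ (suc d) g = trans (shift-∑ d (g ∘ next)) (next-∑ g)

  shift-injective : ∀ {n} d {x y : Fin (suc n)} → shift d x ≡ shift d y → x ≡ y
  shift-injective zero    e = e
  shift-injective (suc d) e = shift-injective d (next-injective e)

  shift-≡ᶻ : ∀ {n} d (x : Fin (suc n)) → + toℕ (shift d x) ≡ᶻ + (toℕ x + d) [mod suc n ]
  shift-≡ᶻ zero    x = ≡ᶻ-reflexive (cong +_ (sym (ℕP.+-identityʳ (toℕ x))))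
  shift-≡ᶻ {n} (suc d) x = begin
      + toℕ (next (shift d x))        ≈⟨ ≡[mod]⇒≡ᶻ (suc n) (next-≡ (shift d x)) ⟩
      + 1 ℤ.+ + toℕ (shift d x)       ≈⟨ +-cong (≡ᶻ-refl {x = + 1}) (shift-≡ᶻ d x) ⟩
      + (1 + (toℕ x + d))             ≡⟨ cong +_ (sym (ℕP.+-suc (toℕ x) d)) ⟩
      + (toℕ x + suc d)               ∎
    where open SetoidReasoning (ℤmod (suc n))

  RowSetoid MatSetoid : ℕ → ℕ → Setoid 0ℓ 0ℓ
  RowSetoid m k = Pointwise.≋-setoid (≡-setoid (Fin m)) k
  MatSetoid m k = Pointwise.≋-setoid (RowSetoid m k) k

  shiftMat : ∀ {m k} → (Fin k → Fin k → ℕ) → Mat (Fin (suc m)) k → Mat (Fin (suc m)) k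
  shiftMat d A r c = shift (d r c) (A r c)

  shiftMat-invariant : ∀ m k (d : Fin k → Fin k → ℕ) →
                       Invariant (MatSetoid (suc m) k) (allMats (suc m) k) (shiftMat d)
  shiftMat-invariant m k d =
    allFuns-invariant (RowSetoid (suc m) k) k (allFuns k (allFin (suc m)))
      (λ r row c → shift (d r c) (row c))
      (λ r → allFuns-invariant (≡-setoid (Fin (suc m))) k (allFin (suc m)) (λ c → shift (d r c))
               (λ c g _ → shift-invariant (d r c) g))
    where
    shift-invariant : ∀ e g → total g (allFin (suc m)) ≡ total (g ∘ shift e) (allFin (suc m))
    shift-invariant e g = trans (total-tabulate g id)
      (trans (sym (shift-∑ e g)) (sym (total-tabulate (g ∘ shift e) id)))

  count-shift : ∀ {m k} (d : Fin k → Fin k → ℕ) {P Q : Mat (Fin (suc m)) k → Set}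
    (P? : ∀ A → Dec (P A)) (Q? : ∀ A → Dec (Q A)) →
    (∀ A → P A → Q (shiftMat d A)) → (∀ A → Q (shiftMat d A) → P A) →
    (∀ {A A′} → (∀ r c → A r c ≡ A′ r c) → Q A → Q A′) →
    countMats (suc m) k P? ≡ countMats (suc m) k Q?
  count-shift {m} {k} d P? Q? P⇒Q Q⇒P Q-resp = begin
    length (filter P? matrices)
      ≡⟨ count≡total P? matrices ⟩
    total (indicator P?) matrices
      ≡⟨ total-cong matrices (λ A → indicator-⇔ P? Q? (P⇒Q A) (Q⇒P A)) ⟩
    total (indicator Q? ∘ shiftMat d) matrices
      ≡⟨ shiftMat-invariant m k d (indicator Q?) indicator-resp ⟨
    total (indicator Q?) matrices
      ≡⟨ count≡total Q? matrices ⟨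
    length (filter Q? matrices) ∎
    where
    open ≡-Reasoning
    matrices : List (Mat (Fin (suc m)) k)
    matrices = allMats (suc m) k
    indicator-resp : ∀ {A A′} → (∀ r c → A r c ≡ A′ r c) → indicator Q? A ≡ indicator Q? A′
    indicator-resp A≡A′ = indicator-⇔ Q? Q? (Q-resp A≡A′) (Q-resp (λ r c → sym (A≡A′ r c)))

module BlockDiagonalisation where

  open Shears
  open IntegerCongruences
  open Units
  open Elimination
  open Counting
  open import Data.Nat as ℕ using (zero)
  open import Data.Integer using (ℤ; +_; _+_; _*_; -_; _-_)
  import Data.Integer.Properties as ℤP
  open import Data.Integer.Divisibility.Signed using (divides)
  open import Data.Integer.Tactic.RingSolver using (solve-∀)
  import Relation.Binary.Reasoning.Setoid as SetoidReasoning
  open import Relation.Binary.PropositionalEquality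
    using (refl; sym; trans; cong; cong₂; subst; module ≡-Reasoning)

  transform : ∀ m .{{_ : NonZero m}} {k} → Mat (Fin m) (suc (suc k)) → Mat ℕ (suc (suc k))
  transform m A = Clearing.clearingShear m (entries A)

  Event-resp : ∀ p m .{{_ : NonZero m}} k t₁₁ t₁₂ t₂₂ B {A A′ : Mat (Fin m) (suc (suc k))} →
    (∀ r c → A r c ≡ A′ r c) →
    Event p m k (transform m) t₁₁ t₁₂ t₂₂ B A → Event p m k (transform m) t₁₁ t₁₂ t₂₂ B A′
  Event-resp p m k t₁₁ t₁₂ t₂₂ B {A} {A′} A≡A′ (A-sym , a≡0 , b≢0 , a≡t , b≡t , c≡t , lower) =
    (λ r c → trans (sym (A≡A′ r c)) (trans (A-sym r c) (A≡A′ c r))) ,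
    subst (λ t → toℕ t ≡ 0 [mod p ]) (A≡A′ zero zero) a≡0 ,
    subst (λ t → ¬ (toℕ t ≡ 0 [mod p ])) (A≡A′ zero (suc zero)) b≢0 ,
    trans (sym (A≡A′ zero zero)) a≡t ,
    trans (sym (A≡A′ zero (suc zero))) b≡t ,
    trans (sym (A≡A′ (suc zero) (suc zero))) c≡t ,
    λ i j → trans (cong (modN m) (sym (conj-cong (suc (suc i)) (suc (suc j))))) (lower i j)
    where
    N≡N′ : ∀ r c → entries A r c ≡ entries A′ r c
    N≡N′ r c = cong toℕ (A≡A′ r c)
    V≡V′ : ∀ r c → transform m A r c ≡ transform m A′ r c
    V≡V′ = Clearing.clearingShear-cong m N≡N′
    conj-cong : ∀ r c → conj (transform m A) A r c ≡ conj (transform m A′) A′ r c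
    conj-cong = ⊗-cong (⊗-cong V≡V′ N≡N′) (λ r c → V≡V′ c r)

  module LowerShift (p n k : ℕ) (t₁₁ t₁₂ t₂₂ : Fin (suc n)) (B B′ : Mat (Fin (suc n)) k)
                    (B-sym : Symmetric B) (B′-sym : Symmetric B′) where

    -- The shift amounts: 0 on the border and  b′ + n b ≡ b′ − b (mod n + 1)  in the lower block.
    amount : Fin (suc (suc k)) → Fin (suc (suc k)) → ℕ
    amount zero          c             = 0
    amount (suc zero)    c             = 0
    amount (suc (suc i)) zero          = 0
    amount (suc (suc i)) (suc zero)    = 0
    amount (suc (suc i)) (suc (suc j)) = toℕ (B′ i j) ℕ.+ n ℕ.* toℕ (B i j)

    amount-sym : ∀ r c → amount r c ≡ amount c r
    amount-sym zero          zero          = refl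
    amount-sym zero          (suc zero)    = refl
    amount-sym zero          (suc (suc j)) = refl
    amount-sym (suc zero)    zero          = refl
    amount-sym (suc zero)    (suc zero)    = refl
    amount-sym (suc zero)    (suc (suc j)) = refl
    amount-sym (suc (suc i)) zero          = refl
    amount-sym (suc (suc i)) (suc zero)    = refl
    amount-sym (suc (suc i)) (suc (suc j)) =
      cong₂ (λ b′ b → toℕ b′ ℕ.+ n ℕ.* toℕ b) (B′-sym i j) (B-sym i j)

    δ : Fin k → Fin k → ℤ
    δ i j = + toℕ (B′ i j) - + toℕ (B i j)

    amount-≡ᶻ : ∀ i j → + amount (suc (suc i)) (suc (suc j)) ≡ᶻ δ i j [mod suc n ]
    amount-≡ᶻ i j = divides-difference (divides (+ b) (begin
        + (b′ ℕ.+ n ℕ.* b) - (+ b′ - + b)     ≡⟨ cong (_- (+ b′ - + b)) (pos-+-* b′ n b) ⟩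
        + b′ + + n * + b - (+ b′ - + b)       ≡⟨ regroup (+ b′) (+ n) (+ b) ⟩
        + b * (+ 1 + + n)                     ∎))
      where
      open ≡-Reasoning
      b b′ : ℕ
      b = toℕ (B i j)
      b′ = toℕ (B′ i j)
      regroup : ∀ b′ n b → b′ + n * b - (b′ - b) ≡ b * (+ 1 + n)
      regroup = solve-∀

    φ : Mat (Fin (suc n)) (suc (suc k)) → Mat (Fin (suc n)) (suc (suc k))
    φ = shiftMat amount

    lowerEntry : Mat (Fin (suc n)) (suc (suc k)) → Fin k → Fin k → ℕ
    lowerEntry A i j = conj (transform (suc n) A) A (suc (suc i)) (suc (suc j))

    -- φ A has the same border as A (the amounts vanish there), hence the same transform
    -- and the same border term T; only the entry D moves, by δ.
    lower-shift : ∀ A i j → + lowerEntry (φ A) i j ≡ᶻ + lowerEntry A i j + δ i j [mod suc n ]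
    lower-shift A i j = begin
        + lowerEntry (φ A) i j
          ≡⟨ cong +_ (shear-conj-lower (αs N) (βs N) (entries (φ A)) i j) ⟩
        + (T ℕ.+ toℕ (shift d D))
          ≡⟨ ℤP.pos-+ T _ ⟩
        + T + + toℕ (shift d D)
          ≈⟨ +-cong (≡ᶻ-refl {x = + T}) (shift-≡ᶻ d D) ⟩
        + T + + (toℕ D ℕ.+ d)
          ≡⟨ cong (_+_ (+ T)) (ℤP.pos-+ (toℕ D) d) ⟩
        + T + (+ toℕ D + + d)
          ≈⟨ +-cong (≡ᶻ-refl {x = + T}) (+-cong (≡ᶻ-refl {x = + toℕ D}) (amount-≡ᶻ i j)) ⟩
        + T + (+ toℕ D + δ i j)
          ≡⟨ ℤP.+-assoc (+ T) (+ toℕ D) (δ i j) ⟨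
        + T + + toℕ D + δ i j
          ≡⟨ cong (_+ δ i j) (ℤP.pos-+ T (toℕ D)) ⟨
        + (T ℕ.+ toℕ D) + δ i j
          ≡⟨ cong (λ t → + t + δ i j) (shear-conj-lower (αs N) (βs N) N i j) ⟨
        + lowerEntry A i j + δ i j ∎
      where
      open SetoidReasoning (ℤmod (suc n))
      open Clearing (suc n) using (αs; βs)
      N : Mat ℕ (suc (suc k))
      N = entries A
      T d : ℕ
      T = borderTerm (αs N) (βs N) N i j
      d = amount (suc (suc i)) (suc (suc j))
      D : Fin (suc n)
      D = A (suc (suc i)) (suc (suc j))

    Event[_] : Mat (Fin (suc n)) k → Mat (Fin (suc n)) (suc (suc k)) → Set
    Event[ C ] = Event p (suc n) k (transform (suc n)) t₁₁ t₁₂ t₂₂ C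

    -- The border hypotheses are untouched by φ; symmetry is preserved (the amounts are
    -- symmetric) and reflected (shifts are injective); the lower block moves by δ.
    forward : ∀ A → Event[ B ] A → Event[ B′ ] (φ A)
    forward A (A-sym , a≡0 , b≢0 , a≡t , b≡t , c≡t , lower) =
      (λ r c → cong₂ shift (amount-sym r c) (A-sym r c)) , a≡0 , b≢0 , a≡t , b≡t , c≡t ,
      λ i j → ≡ᶻ⇒≡[mod] (suc n) (begin
        + lowerEntry (φ A) i j      ≈⟨ lower-shift A i j ⟩
        + lowerEntry A i j + δ i j  ≈⟨ +-cong (≡[mod]⇒≡ᶻ (suc n) (lower i j)) (≡ᶻ-refl {x = δ i j}) ⟩
        + toℕ (B i j) + δ i j       ≡⟨ cancel (+ toℕ (B i j)) (+ toℕ (B′ i j)) ⟩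
        + toℕ (B′ i j)              ∎)
      where
      open SetoidReasoning (ℤmod (suc n))
      cancel : ∀ b b′ → b + (b′ - b) ≡ b′
      cancel = solve-∀

    backward : ∀ A → Event[ B′ ] (φ A) → Event[ B ] A
    backward A (φA-sym , a≡0 , b≢0 , a≡t , b≡t , c≡t , lower) =
      (λ r c → shift-injective (amount r c)
                 (trans (φA-sym r c) (cong (λ e → shift e (A c r)) (amount-sym c r)))) ,
      a≡0 , b≢0 , a≡t , b≡t , c≡t ,
      λ i j → ≡ᶻ⇒≡[mod] (suc n) (begin
        + lowerEntry A i j
          ≡⟨ uncancel (+ lowerEntry A i j) (δ i j) ⟩
        + lowerEntry A i j + δ i j - δ i j
          ≈⟨ +-cong (≡ᶻ-sym (lower-shift A i j)) (≡ᶻ-refl {x = - δ i j}) ⟩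
        + lowerEntry (φ A) i j - δ i j
          ≈⟨ +-cong (≡[mod]⇒≡ᶻ (suc n) (lower i j)) (≡ᶻ-refl {x = - δ i j}) ⟩
        + toℕ (B′ i j) - δ i j
          ≡⟨ cancel (+ toℕ (B i j)) (+ toℕ (B′ i j)) ⟩
        + toℕ (B i j) ∎)
      where
      open SetoidReasoning (ℤmod (suc n))
      uncancel : ∀ c e → c ≡ c + e - e
      uncancel = solve-∀
      cancel : ∀ b b′ → b′ - (b′ - b) ≡ b
      cancel = solve-∀

    count : countMats (suc n) (suc (suc k)) (Event? p (suc n) k (transform (suc n)) t₁₁ t₁₂ t₂₂ B)
          ≡ countMats (suc n) (suc (suc k)) (Event? p (suc n) k (transform (suc n)) t₁₁ t₁₂ t₂₂ B′)
    count = count-shift amount _ _ forward backward (Event-resp p (suc n) k t₁₁ t₁₂ t₂₂ B′)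

  event-count : ∀ p m .{{_ : NonZero m}} k (t₁₁ t₁₂ t₂₂ : Fin m) (B B′ : Mat (Fin m) k) →
    Symmetric B → Symmetric B′ →
    countMats m (suc (suc k)) (Event? p m k (transform m) t₁₁ t₁₂ t₂₂ B)
      ≡ countMats m (suc (suc k)) (Event? p m k (transform m) t₁₁ t₁₂ t₂₂ B′)
  event-count p (suc n) k t₁₁ t₁₂ t₂₂ B B′ B-sym B′-sym =
    LowerShift.count p n k t₁₁ t₁₂ t₂₂ B B′ B-sym B′-sym

  top-left-unit : ∀ {p} μ {k} → Prime p → (A : Mat (Fin (p ℕ.^ μ)) (suc (suc k))) →
    toℕ (A zero zero) ≡ 0 [mod p ] → ¬ (toℕ (A zero (suc zero)) ≡ 0 [mod p ]) →
    let d = det (entries A) in d * inverse (p ℕ.^ μ) d ≡ᶻ + 1 [mod p ℕ.^ μ ]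
  top-left-unit {p} μ isPrime A a≡0 b≢0 = unit-mod-prime-power μ _ isPrime
    (det-not-divisible _ _ _ isPrime (≡0[mod]⇒∣ p a≡0) (λ p∣b → b≢0 (∣⇒≡0[mod] p p∣b)))

  transform-block-diagonal : ∀ n .{{_ : NonZero n}} {k} (A : Mat (Fin n) (suc (suc k))) →
    Symmetric A → det (entries A) * inverse n (det (entries A)) ≡ᶻ + 1 [mod n ] →
    InvertibleMod n (transform n A) ×
    (conj (transform n A) A zero zero ≡ toℕ (A zero zero) [mod n ]) ×
    (conj (transform n A) A zero (suc zero) ≡ toℕ (A zero (suc zero)) [mod n ]) ×
    (conj (transform n A) A (suc zero) zero ≡ toℕ (A (suc zero) zero) [mod n ]) ×
    (conj (transform n A) A (suc zero) (suc zero) ≡ toℕ (A (suc zero) (suc zero)) [mod n ]) ×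
    (∀ i → conj (transform n A) A zero (suc (suc i)) ≡ 0 [mod n ]) ×
    (∀ i → conj (transform n A) A (suc zero) (suc (suc i)) ≡ 0 [mod n ]) ×
    (∀ i → conj (transform n A) A (suc (suc i)) zero ≡ 0 [mod n ]) ×
    (∀ i → conj (transform n A) A (suc (suc i)) (suc zero) ≡ 0 [mod n ])
  transform-block-diagonal n {k} A A-sym unit =
    shear-invertible n _ _ ,
    expand zero zero , expand zero (suc zero) , expand (suc zero) zero , expand (suc zero) (suc zero) ,
    Clearing.clearingShear-clears-border n N (λ r c → cong toℕ (A-sym r c)) unit
    where
    open Clearing n using (αs; βs)
    N : Mat ℕ (suc (suc k))
    N = entries A
    -- for r , s < 2 the right-hand side reduces to N r s
    expand : ∀ r s → conj (transform n A) A r s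
                       ≡ shearRow (αs N) (βs N) s (λ l → shearRow (αs N) (βs N) r (λ l′ → N l′ l))
                         [mod n ]
    expand r s = cong (modN n) (shear-conj (αs N) (βs N) N r s)

open BlockDiagonalisation

lemma2p2 : (p μ k : ℕ) → Prime p → 1 ≤ k →
    Σ (Mat (Fin (p ^ μ)) (suc (suc k)) → Mat ℕ (suc (suc k))) (λ V →
      (∀ (A : Mat (Fin (p ^ μ)) (suc (suc k))) → Symmetric A →
        toℕ (A zero zero) ≡ 0 [mod p ] →
        ¬ (toℕ (A zero (suc zero)) ≡ 0 [mod p ]) →
        InvertibleMod (p ^ μ) (V A) ×
        (conj (V A) A zero zero ≡ toℕ (A zero zero) [mod p ^ μ ]) ×
        (conj (V A) A zero (suc zero) ≡ toℕ (A zero (suc zero)) [mod p ^ μ ]) ×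
        (conj (V A) A (suc zero) zero ≡ toℕ (A (suc zero) zero) [mod p ^ μ ]) ×
        (conj (V A) A (suc zero) (suc zero) ≡ toℕ (A (suc zero) (suc zero)) [mod p ^ μ ]) ×
        (∀ (i : Fin k) → conj (V A) A zero (suc (suc i)) ≡ 0 [mod p ^ μ ]) ×
        (∀ (i : Fin k) → conj (V A) A (suc zero) (suc (suc i)) ≡ 0 [mod p ^ μ ]) ×
        (∀ (i : Fin k) → conj (V A) A (suc (suc i)) zero ≡ 0 [mod p ^ μ ]) ×
        (∀ (i : Fin k) → conj (V A) A (suc (suc i)) (suc zero) ≡ 0 [mod p ^ μ ]))
      ×
      (∀ (t₁₁ t₁₂ t₂₂ : Fin (p ^ μ)) (B B′ : Mat (Fin (p ^ μ)) k) →
        Symmetric B → Symmetric B′ →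
        countMats (p ^ μ) (suc (suc k)) (Event? p (p ^ μ) k V t₁₁ t₁₂ t₂₂ B)
          ≡ countMats (p ^ μ) (suc (suc k)) (Event? p (p ^ μ) k V t₁₁ t₁₂ t₂₂ B′)))
lemma2p2 p μ k isPrime _ =
  transform (p ^ μ) ,
  (λ A A-sym a≡0 b≢0 →
     transform-block-diagonal (p ^ μ) A A-sym (top-left-unit μ isPrime A a≡0 b≢0)) ,
  event-count p (p ^ μ) k
  where
  instance
    p^μ≢0 : NonZero (p ^ μ)
    p^μ≢0 = m^n≢0 p μ {{prime⇒nonZero isPrime}}
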